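{- For every positive integer $n$ and every $\pi\in\Pi(n)$, $|S_{\mathrm{out}}(\pi)\cap S_{\mathrm{in}}(\pi)| = 1 + \binom{n}{2} + \binom{n}{3}$.
   Context: $\Pi(n)$ denotes the set of permutations of $\{1,\dots,n\}$, each regarded as a sequence $\pi=(\pi_1,\dots,\pi_n)$. A TDRL operation on $\pi$ is specified by a binary pattern $b\in\{0,1\}^n$. Its result is the concatenation of the subsequence $(\pi_i : b_i=1)$ with the subsequence $(\pi_i : b_i=0)$, each taken with indices in increasing order. Write $\pi\to\rho$ if $\rho$ is the result of some TDRL operation on $\pi$. Define $S_{\mathrm{out}}(\pi)=\{\rho:\pi\to\rho\}$ and $S_{\mathrm{in}}(\pi)=\{\rho:\rho\to\pi\}$. -}

module Defs where

open import Data.Nat using (ℕ)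
open import Data.Bool using (Bool; true; false)
open import Data.Fin using (Fin)
open import Data.List using (List; []; _∷_; _++_; length; allFin)
open import Data.Product using (Σ; _×_; ∃)
open import Relation.Binary.PropositionalEquality using (_≡_)
open import Data.List.Relation.Binary.Permutation.Propositional using (_↭_)

-- Π(n): sequences over {1..n} (encoded as Fin n = {0..n-1}) that are permutations
Perm : ℕ → Set
Perm n = Σ (List (Fin n)) (λ π → π ↭ allFin n)

keep1 : {A : Set} → List Bool → List A → List A
keep1 (true ∷ b) (x ∷ xs) = x ∷ keep1 b xs
keep1 (false ∷ b) (x ∷ xs) = keep1 b xs
keep1 _ _ = []

keep0 : {A : Set} → List Bool → List A → List A
keep0 (true ∷ b) (x ∷ xs) = keep0 b xs
keep0 (false ∷ b) (x ∷ xs) = x ∷ keep0 b xs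
keep0 _ _ = []

tdrl : {A : Set} → List Bool → List A → List A
tdrl b π = keep1 b π ++ keep0 b π

_⟶_ : {A : Set} → List A → List A → Set
π ⟶ ρ = ∃ λ (b : List Bool) → (length b ≡ length π) × (tdrl b π ≡ ρ)

module Submission where

-- For a duplicate-free list xs, the TDRL results ρ with xs ⟶ ρ and ρ ⟶ xs are
-- exactly the *block swaps* of xs: the lists P ++ V ++ U ++ W obtained from a
-- factorisation xs = P ++ U ++ V ++ W by exchanging two adjacent blocks.
--
-- 1. Every block swap is reachable in both directions: the pattern 1^|P| 0^|U|
--    1^|V| 0^|W| maps P U V W to P V U W, and exchanging the roles of U and V
--    maps it back (blockSwap⟶).
-- 2. We enumerate block swaps by an explicit list  swaps xs , built by
--    recursion on xs, and show it is sound (every entry is a block swap),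
--    complete (every ρ in the intersection occurs), and duplicate-free.
--    Completeness is by induction on xs, analysing where the TDRL operation
--    sends the first element x (tdrl-intersection-complete).
-- 3. The recursion for  swaps  gives |swaps xs| = 1 + C(m,2) + C(m,3) for
--    m = length xs, by Pascal's rule.

open import Defs
open import Data.Nat using (ℕ; suc; _+_)
open import Data.Nat.Properties using (suc-injective; +-comm)
open import Data.Nat.Combinatorics using (_C_; nC1≡n; nCk+nC[k+1]≡[n+1]C[k+1])
open import Data.Fin using (Fin)
open import Data.Bool using (Bool; true; false)
open import Data.List using (List; []; _∷_; _++_; length; map; replicate)
open import Data.List.Properties
  using (∷-injectiveˡ; ∷-injectiveʳ; length-map; length-++; length-replicate; length-tabulate; ++-assoc)
open import Data.List.Membership.Propositional using (_∈_; _∉_)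
open import Data.List.Membership.Propositional.Properties
  using (∈-map⁺; ∈-map⁻; ∈-++⁺ˡ; ∈-++⁺ʳ; ∈-++⁻)
open import Data.List.Relation.Unary.Any using (here; there)
open import Data.List.Relation.Unary.All using () renaming ([] to []ᴬ; tabulate to tabulateᴬ)
open import Data.List.Relation.Unary.AllPairs using ([]; _∷_)
open import Data.List.Relation.Unary.Unique.Propositional using (Unique)
open import Data.List.Relation.Unary.Unique.Propositional.Properties
  using (allFin⁺; map⁺; ++⁺; Unique[x∷xs]⇒x∉xs)
open import Data.List.Relation.Binary.Permutation.Propositional using (↭-sym; ↭⇒↭ₛ)
open import Data.List.Relation.Binary.Permutation.Propositional.Properties using (↭-length)
open import Data.List.Relation.Binary.Permutation.Setoid.Properties using (Unique-resp-↭)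
open import Data.Product using (_×_; ∃; _,_; proj₁; proj₂)
open import Data.Sum using (inj₁; inj₂)
open import Data.Empty using (⊥-elim)
open import Function.Bundles using (_⇔_; mk⇔)
open import Relation.Nullary using (¬_)
open import Relation.Binary.PropositionalEquality
  using (_≡_; _≢_; refl; sym; trans; cong; cong₂; subst; subst₂; setoid; module ≡-Reasoning)

module _ {A : Set} where

  keep1-⊆ : ∀ (b : List Bool) (xs : List A) {y} → y ∈ keep1 b xs → y ∈ xs
  keep1-⊆ (true ∷ b) (x ∷ xs) (here p) = here p
  keep1-⊆ (true ∷ b) (x ∷ xs) (there m) = there (keep1-⊆ b xs m)
  keep1-⊆ (false ∷ b) (x ∷ xs) m = there (keep1-⊆ b xs m)

  keep0-⊆ : ∀ (b : List Bool) (xs : List A) {y} → y ∈ keep0 b xs → y ∈ xs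
  keep0-⊆ (false ∷ b) (x ∷ xs) (here p) = here p
  keep0-⊆ (false ∷ b) (x ∷ xs) (there m) = there (keep0-⊆ b xs m)
  keep0-⊆ (true ∷ b) (x ∷ xs) m = there (keep0-⊆ b xs m)

  tdrl-⊆ : ∀ (b : List Bool) (xs : List A) {y} → y ∈ tdrl b xs → y ∈ xs
  tdrl-⊆ b xs m with ∈-++⁻ (keep1 b xs) m
  ... | inj₁ m1 = keep1-⊆ b xs m1
  ... | inj₂ m0 = keep0-⊆ b xs m0

  keep0-of-empty-keep1 : ∀ (b : List Bool) (xs : List A) → length b ≡ length xs →
                         keep1 b xs ≡ [] → keep0 b xs ≡ xs
  keep0-of-empty-keep1 [] [] _ _ = refl
  keep0-of-empty-keep1 (false ∷ b) (x ∷ xs) l e =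
    cong (x ∷_) (keep0-of-empty-keep1 b xs (suc-injective l) e)

  block : Bool → List A → List Bool
  block v U = replicate (length U) v

  keep1-block-true : ∀ (U : List A) b xs → keep1 (block true U ++ b) (U ++ xs) ≡ U ++ keep1 b xs
  keep1-block-true [] b xs = refl
  keep1-block-true (u ∷ U) b xs = cong (u ∷_) (keep1-block-true U b xs)

  keep1-block-false : ∀ (U : List A) b xs → keep1 (block false U ++ b) (U ++ xs) ≡ keep1 b xs
  keep1-block-false [] b xs = refl
  keep1-block-false (u ∷ U) b xs = keep1-block-false U b xs

  keep0-block-true : ∀ (U : List A) b xs → keep0 (block true U ++ b) (U ++ xs) ≡ keep0 b xs
  keep0-block-true [] b xs = refl
  keep0-block-true (u ∷ U) b xs = keep0-block-true U b xs

  keep0-block-false : ∀ (U : List A) b xs → keep0 (block false U ++ b) (U ++ xs) ≡ U ++ keep0 b xs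
  keep0-block-false [] b xs = refl
  keep0-block-false (u ∷ U) b xs = cong (u ∷_) (keep0-block-false U b xs)

  keep1-all-false : ∀ (W : List A) → keep1 (block false W) W ≡ []
  keep1-all-false [] = refl
  keep1-all-false (w ∷ W) = keep1-all-false W

  keep0-all-false : ∀ (W : List A) → keep0 (block false W) W ≡ W
  keep0-all-false [] = refl
  keep0-all-false (w ∷ W) = cong (w ∷_) (keep0-all-false W)

  length-block++ : ∀ (U : List A) v (b : List Bool) xs → length b ≡ length xs →
                   length (block v U ++ b) ≡ length (U ++ xs)
  length-block++ [] v b xs l = l
  length-block++ (u ∷ U) v b xs l = cong suc (length-block++ U v b xs l)

  blockSwap⟶ : ∀ (P U V W : List A) → (P ++ U ++ V ++ W) ⟶ (P ++ V ++ U ++ W)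
  blockSwap⟶ P U V W = b , len , result
    where
    open ≡-Reasoning
    bVW bUVW b : List Bool
    bVW  = block true V ++ block false W
    bUVW = block false U ++ bVW
    b    = block true P ++ bUVW
    len : length b ≡ length (P ++ U ++ V ++ W)
    len = length-block++ P true _ _ (length-block++ U false _ _
            (length-block++ V true _ _ (length-replicate (length W))))
    selected : keep1 b (P ++ U ++ V ++ W) ≡ P ++ V ++ []
    selected = begin
      keep1 b (P ++ U ++ V ++ W)          ≡⟨ keep1-block-true P bUVW (U ++ V ++ W) ⟩
      P ++ keep1 bUVW (U ++ V ++ W)       ≡⟨ cong (P ++_) (keep1-block-false U bVW (V ++ W)) ⟩
      P ++ keep1 bVW (V ++ W)             ≡⟨ cong (P ++_) (keep1-block-true V (block false W) W) ⟩
      P ++ V ++ keep1 (block false W) W   ≡⟨ cong (λ z → P ++ V ++ z) (keep1-all-false W) ⟩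
      P ++ V ++ []                        ∎
    rest : keep0 b (P ++ U ++ V ++ W) ≡ U ++ W
    rest = begin
      keep0 b (P ++ U ++ V ++ W)          ≡⟨ keep0-block-true P bUVW (U ++ V ++ W) ⟩
      keep0 bUVW (U ++ V ++ W)            ≡⟨ keep0-block-false U bVW (V ++ W) ⟩
      U ++ keep0 bVW (V ++ W)             ≡⟨ cong (U ++_) (keep0-block-true V (block false W) W) ⟩
      U ++ keep0 (block false W) W        ≡⟨ cong (U ++_) (keep0-all-false W) ⟩
      U ++ W                              ∎
    result : tdrl b (P ++ U ++ V ++ W) ≡ P ++ V ++ U ++ W
    result = begin
      tdrl b (P ++ U ++ V ++ W)                  ≡⟨ cong₂ _++_ selected rest ⟩
      (P ++ V ++ []) ++ U ++ W                   ≡⟨ ++-assoc P (V ++ []) (U ++ W) ⟩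
      P ++ (V ++ []) ++ U ++ W                   ≡⟨ cong (P ++_) (++-assoc V [] (U ++ W)) ⟩
      P ++ V ++ U ++ W                           ∎

  -- insertAfterPrefix X ys : all P ++ X ++ R with ys = P ++ R and P nonempty.
  insertAfterPrefix : List A → List A → List (List A)
  insertAfterPrefix X [] = []
  insertAfterPrefix X (y ∷ ys) = (y ∷ X ++ ys) ∷ map (y ∷_) (insertAfterPrefix X ys)

  -- frontSwaps X xs : all P ++ X ++ K ++ R with xs = K ++ P ++ R and P nonempty,
  -- i.e. the block X ++ K is moved behind the nonempty block P following it.
  frontSwaps : List A → List A → List (List A)
  frontSwaps X [] = []
  frontSwaps X (y ∷ ys) = insertAfterPrefix X (y ∷ ys) ++ frontSwaps (X ++ y ∷ []) ys

  -- swaps xs : the identity, the swaps keeping the head, and those moving it.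
  swaps : List A → List (List A)
  swaps [] = [] ∷ []
  swaps (x ∷ xs) = map (x ∷_) (swaps xs) ++ frontSwaps (x ∷ []) xs

  insertAfterPrefix-shape : ∀ X xs {ρ} → ρ ∈ insertAfterPrefix X xs →
    ∃ λ P → ∃ λ R → xs ≡ P ++ R × ρ ≡ P ++ X ++ R
  insertAfterPrefix-shape X (y ∷ ys) (here e) = y ∷ [] , ys , refl , e
  insertAfterPrefix-shape X (y ∷ ys) (there m) with ∈-map⁻ (y ∷_) m
  ... | z , mz , e with insertAfterPrefix-shape X ys mz
  ... | P , R , e1 , e2 = y ∷ P , R , cong (y ∷_) e1 , trans e (cong (y ∷_) e2)

  frontSwaps-shape : ∀ X xs {ρ} → ρ ∈ frontSwaps X xs →
    ∃ λ K → ∃ λ P → ∃ λ R → xs ≡ K ++ P ++ R × ρ ≡ P ++ X ++ K ++ R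
  frontSwaps-shape X (y ∷ ys) m with ∈-++⁻ (insertAfterPrefix X (y ∷ ys)) m
  ... | inj₁ mb with insertAfterPrefix-shape X (y ∷ ys) mb
  ...   | P , R , e1 , e2 = [] , P , R , e1 , e2
  frontSwaps-shape X (y ∷ ys) m | inj₂ mj with frontSwaps-shape (X ++ y ∷ []) ys mj
  ...   | K , P , R , e1 , e2 =
    y ∷ K , P , R , cong (y ∷_) e1 , trans e2 (cong (P ++_) (++-assoc X (y ∷ []) (K ++ R)))

  swaps-shape : ∀ xs {ρ} → ρ ∈ swaps xs →
    ∃ λ P → ∃ λ U → ∃ λ V → ∃ λ W → xs ≡ P ++ U ++ V ++ W × ρ ≡ P ++ V ++ U ++ W
  swaps-shape [] (here e) = [] , [] , [] , [] , refl , e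
  swaps-shape (x ∷ xs) m with ∈-++⁻ (map (x ∷_) (swaps xs)) m
  ... | inj₁ mm with ∈-map⁻ (x ∷_) mm
  ...   | z , mz , e with swaps-shape xs mz
  ...     | P , U , V , W , e1 , e2 =
    x ∷ P , U , V , W , cong (x ∷_) e1 , trans e (cong (x ∷_) e2)
  swaps-shape (x ∷ xs) m | inj₂ mj with frontSwaps-shape (x ∷ []) xs mj
  ...   | K , P , R , e1 , e2 = [] , x ∷ K , P , R , cong (x ∷_) e1 , e2

  swaps-sound : ∀ xs {ρ} → ρ ∈ swaps xs → (xs ⟶ ρ) × (ρ ⟶ xs)
  swaps-sound xs m with swaps-shape xs m
  ... | P , U , V , W , e1 , e2 =
    subst₂ _⟶_ (sym e1) (sym e2) (blockSwap⟶ P U V W) ,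
    subst₂ _⟶_ (sym e2) (sym e1) (blockSwap⟶ P V U W)

  ∈-insertAfterPrefix : ∀ X p P R → (p ∷ P) ++ X ++ R ∈ insertAfterPrefix X ((p ∷ P) ++ R)
  ∈-insertAfterPrefix X p [] R = here refl
  ∈-insertAfterPrefix X p (q ∷ P) R = there (∈-map⁺ (p ∷_) (∈-insertAfterPrefix X q P R))

  ∈-frontSwaps : ∀ X K p P R → (p ∷ P) ++ X ++ K ++ R ∈ frontSwaps X (K ++ (p ∷ P) ++ R)
  ∈-frontSwaps X [] p P R = ∈-++⁺ˡ (∈-insertAfterPrefix X p P R)
  ∈-frontSwaps X (k ∷ K) p P R =
    ∈-++⁺ʳ (insertAfterPrefix X (k ∷ K ++ (p ∷ P) ++ R))
      (subst (λ z → z ∈ frontSwaps (X ++ k ∷ []) (K ++ (p ∷ P) ++ R))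
        (cong ((p ∷ P) ++_) (++-assoc X (k ∷ []) (K ++ R)))
        (∈-frontSwaps (X ++ k ∷ []) K p P R))

  keep0-complement-of-middle : ∀ b K P R → Unique (K ++ P ++ R) →
    length b ≡ length (K ++ P ++ R) → keep1 b (K ++ P ++ R) ≡ P → keep0 b (K ++ P ++ R) ≡ K ++ R
  keep0-complement-of-middle (true ∷ b) (k ∷ K) P R u l e =
    ⊥-elim (Unique[x∷xs]⇒x∉xs u (∈-++⁺ʳ K (∈-++⁺ˡ (subst (k ∈_) e (here refl)))))
  keep0-complement-of-middle (false ∷ b) (k ∷ K) P R (_ ∷ u) l e =
    cong (k ∷_) (keep0-complement-of-middle b K P R u (suc-injective l) e)
  keep0-complement-of-middle b [] [] R u l e = keep0-of-empty-keep1 b R l e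
  keep0-complement-of-middle (true ∷ b) [] (p ∷ P) R (_ ∷ u) l e =
    keep0-complement-of-middle b [] P R u (suc-injective l) (∷-injectiveʳ e)
  keep0-complement-of-middle (false ∷ b) [] (p ∷ P) R u l e =
    ⊥-elim (Unique[x∷xs]⇒x∉xs u (keep1-⊆ b (P ++ R) (subst (p ∈_) (sym e) (here refl))))

  select-from-occurrence : ∀ (x : A) P Q c K → x ∉ P → x ∉ Q → keep1 c (P ++ x ∷ Q) ≡ x ∷ K →
    ∃ λ c′ → keep1 c′ Q ≡ K × keep0 c (P ++ x ∷ Q) ≡ P ++ keep0 c′ Q
  select-from-occurrence x [] Q (true ∷ c) K x∉P x∉Q e = c , ∷-injectiveʳ e , refl
  select-from-occurrence x [] Q (false ∷ c) K x∉P x∉Q e =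
    ⊥-elim (x∉Q (keep1-⊆ c Q (subst (x ∈_) (sym e) (here refl))))
  select-from-occurrence x (p ∷ P) Q (true ∷ c) K x∉P x∉Q e = ⊥-elim (x∉P (here (sym (∷-injectiveˡ e))))
  select-from-occurrence x (p ∷ P) Q (false ∷ c) K x∉P x∉Q e
    with select-from-occurrence x P Q c K (λ m → x∉P (there m)) x∉Q e
  ... | c′ , e1 , e2 = c′ , e1 , cong (p ∷_) e2

  ⟶-drop-head : ∀ (x : A) ρ xs → x ∉ ρ → (x ∷ ρ) ⟶ (x ∷ xs) → ρ ⟶ xs
  ⟶-drop-head x ρ xs x∉ρ (true ∷ c , l , e) = c , suc-injective l , ∷-injectiveʳ e
  ⟶-drop-head x ρ xs x∉ρ (false ∷ c , l , e) = go (keep1 c ρ) refl e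
    where
    go : ∀ K → keep1 c ρ ≡ K → K ++ x ∷ keep0 c ρ ≡ x ∷ xs → ρ ⟶ xs
    go [] k e′ = c , suc-injective l , trans (cong (_++ keep0 c ρ) k) (∷-injectiveʳ e′)
    go (y ∷ K) k e′ = ⊥-elim (x∉ρ (keep1-⊆ c ρ
      (subst (_∈ keep1 c ρ) (∷-injectiveˡ e′) (subst (y ∈_) (sym k) (here refl)))))

  ⟶-head-kept : ∀ {x : A} {xs ρ} → Unique (x ∷ xs) → xs ⟶ ρ → (x ∷ ρ) ⟶ (x ∷ xs) → ρ ⟶ xs
  ⟶-head-kept {x} {xs} {ρ} u (b , _ , e) back = ⟶-drop-head x ρ xs x∉ρ back
    where
    x∉ρ : x ∉ ρ
    x∉ρ m = Unique[x∷xs]⇒x∉xs u (tdrl-⊆ b xs (subst (x ∈_) (sym e) m))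

  -- The core case of completeness: the forward step moved x behind the nonempty
  -- block P = p ∷ P′ (selected from xs) and left Q.  Then the backward step must
  -- select x together with a prefix K of Q, so that xs = K ++ P ++ R and Q = K ++ R:
  -- ρ is the swap of the blocks x ∷ K and P.
  moved-head-shape : ∀ (x p : A) P′ Q xs b → Unique (x ∷ xs) → length b ≡ length xs →
    keep1 b xs ≡ p ∷ P′ → keep0 b xs ≡ Q → ((p ∷ P′) ++ x ∷ Q) ⟶ (x ∷ xs) →
    ∃ λ K → ∃ λ R → xs ≡ K ++ (p ∷ P′) ++ R × Q ≡ K ++ R
  moved-head-shape x p P′ Q xs b uu@(_ ∷ u) l eP eQ (c , l₂ , e₂) = go (keep1 c ρ) refl
    where
    P = p ∷ P′
    ρ = P ++ x ∷ Q
    x∉xs : x ∉ xs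
    x∉xs = Unique[x∷xs]⇒x∉xs uu
    x∉P : x ∉ P
    x∉P m = x∉xs (keep1-⊆ b xs (subst (x ∈_) (sym eP) m))
    x∉Q : x ∉ Q
    x∉Q m = x∉xs (keep0-⊆ b xs (subst (x ∈_) (sym eQ) m))
    Conclusion : Set
    Conclusion = ∃ λ K → ∃ λ R → xs ≡ K ++ P ++ R × Q ≡ K ++ R
    -- Selecting nothing would keep ρ, whose head p ∈ xs differs from x; so the
    -- selection starts with x ∷ K.
    go : ∀ K → keep1 c ρ ≡ K → Conclusion
    go [] k = ⊥-elim (x∉xs (subst (_∈ xs) p≡x (keep1-⊆ b xs (subst (p ∈_) (sym eP) (here refl)))))
      where
      p≡x : p ≡ x
      p≡x = ∷-injectiveˡ (trans (sym (keep0-of-empty-keep1 c ρ l₂ k))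
                                (trans (sym (cong (_++ keep0 c ρ) k)) e₂))
    go (y ∷ K) k with trans (sym (cong (_++ keep0 c ρ) k)) e₂
    ... | e₂′ with select-from-occurrence x P Q c K x∉P x∉Q (trans k (cong (_∷ K) (∷-injectiveˡ e₂′)))
    ... | c′ , _ , k0e = K , keep0 c′ Q , xs≡ , Q≡
      where
      xs≡ : xs ≡ K ++ P ++ keep0 c′ Q
      xs≡ = trans (sym (∷-injectiveʳ e₂′)) (cong (K ++_) k0e)
      Q≡ : Q ≡ K ++ keep0 c′ Q
      Q≡ = trans (sym eQ) (trans (cong (keep0 b) xs≡)
             (keep0-complement-of-middle b K P (keep0 c′ Q) (subst Unique xs≡ u)
               (trans l (cong length xs≡)) (trans (cong (keep1 b) (sym xs≡)) eP)))

  -- Every ρ in the intersection is listed, by induction on xs: either the forward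
  -- step keeps the head x in front (head-kept, induction hypothesis on the tail),
  -- or it moves x behind a nonempty block (moved-head-shape).
  tdrl-intersection-complete : ∀ xs → Unique xs → ∀ ρ → xs ⟶ ρ → ρ ⟶ xs → ρ ∈ swaps xs
  head-kept : ∀ {x : A} {xs ρ} → Unique (x ∷ xs) → xs ⟶ ρ → (x ∷ ρ) ⟶ (x ∷ xs) →
              (x ∷ ρ) ∈ swaps (x ∷ xs)

  tdrl-intersection-complete [] _ ρ ([] , _ , refl) _ = here refl
  tdrl-intersection-complete (x ∷ xs) u ρ (true ∷ b , l , refl) back =
    head-kept u (b , suc-injective l , refl) back
  tdrl-intersection-complete (x ∷ xs) u ρ (false ∷ b , l , refl) back with keep1 b xs in eP
  ... | [] = head-kept u (b , suc-injective l , cong (_++ keep0 b xs) eP) back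
  ... | p ∷ P′ with moved-head-shape x p P′ (keep0 b xs) xs b u (suc-injective l) eP refl back
  ...   | K , R , xs≡ , Q≡ =
    subst₂ (λ σ ys → σ ∈ swaps (x ∷ ys)) (cong (λ z → (p ∷ P′) ++ x ∷ z) (sym Q≡)) (sym xs≡)
      (∈-++⁺ʳ (map (x ∷_) (swaps (K ++ (p ∷ P′) ++ R))) (∈-frontSwaps (x ∷ []) K p P′ R))

  head-kept {x} {xs} {ρ} u@(_ ∷ u′) fwd back =
    ∈-++⁺ˡ (∈-map⁺ (x ∷_) (tdrl-intersection-complete xs u′ ρ fwd (⟶-head-kept u fwd back)))

  insertAfterPrefix-head : ∀ X y ys {z} → z ∈ insertAfterPrefix X (y ∷ ys) → ∃ λ t → z ≡ y ∷ t
  insertAfterPrefix-head X y ys (here e) = _ , e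
  insertAfterPrefix-head X y ys (there m) with ∈-map⁻ (y ∷_) m
  ... | z′ , _ , e = z′ , e

  insertAfterPrefix-head∈ : ∀ X xs {z} → z ∈ insertAfterPrefix X xs →
    ∃ λ w → ∃ λ t → w ∈ xs × z ≡ w ∷ t
  insertAfterPrefix-head∈ X (y ∷ ys) m with insertAfterPrefix-head X y ys m
  ... | t , e = y , t , here refl , e

  frontSwaps-head∈ : ∀ X xs {z} → z ∈ frontSwaps X xs → ∃ λ w → ∃ λ t → w ∈ xs × z ≡ w ∷ t
  frontSwaps-head∈ X (y ∷ ys) m with ∈-++⁻ (insertAfterPrefix X (y ∷ ys)) m
  ... | inj₁ mb = insertAfterPrefix-head∈ X (y ∷ ys) mb
  ... | inj₂ mj with frontSwaps-head∈ (X ++ y ∷ []) ys mj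
  ...   | w , t , mw , e = w , t , there mw , e

  -- The first entry y ∷ x ∷ X′ ++ ys differs from the later ones y ∷ w ∷ …, w ∈ ys.
  insertAfterPrefix-unique : ∀ (x : A) X′ ys → x ∉ ys → Unique (insertAfterPrefix (x ∷ X′) ys)
  insertAfterPrefix-unique x X′ [] x∉ys = []
  insertAfterPrefix-unique x X′ (y ∷ ys) x∉ys =
    tabulateᴬ first≢later ∷ map⁺ ∷-injectiveʳ (insertAfterPrefix-unique x X′ ys (λ m → x∉ys (there m)))
    where
    first≢later : ∀ {z} → z ∈ map (y ∷_) (insertAfterPrefix (x ∷ X′) ys) → (y ∷ x ∷ X′ ++ ys) ≢ z
    first≢later m eq with ∈-map⁻ (y ∷_) m
    ... | z′ , mz , e with insertAfterPrefix-head∈ (x ∷ X′) ys mz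
    ...   | w , t , mw , e′ =
      x∉ys (there (subst (_∈ ys) (sym (∷-injectiveˡ (trans (∷-injectiveʳ (trans eq e)) e′))) mw))

  -- The two parts of frontSwaps X (y ∷ ys) are told apart by their head: y, or an
  -- element of ys.
  frontSwaps-unique : ∀ (x : A) X′ xs → x ∉ xs → Unique xs → Unique (frontSwaps (x ∷ X′) xs)
  frontSwaps-unique x X′ [] x∉xs u = []
  frontSwaps-unique x X′ (y ∷ ys) x∉xs uu@(_ ∷ u) =
    ++⁺ (insertAfterPrefix-unique x X′ (y ∷ ys) x∉xs)
        (frontSwaps-unique x (X′ ++ y ∷ []) ys (λ m → x∉xs (there m)) u) disjoint
    where
    disjoint : ∀ {v} → ¬ (v ∈ insertAfterPrefix (x ∷ X′) (y ∷ ys) × v ∈ frontSwaps (x ∷ X′ ++ y ∷ []) ys)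
    disjoint (m1 , m2) with insertAfterPrefix-head (x ∷ X′) y ys m1 | frontSwaps-head∈ (x ∷ X′ ++ y ∷ []) ys m2
    ... | t , e | w , t′ , mw , e′ =
      Unique[x∷xs]⇒x∉xs uu (subst (_∈ ys) (sym (∷-injectiveˡ (trans (sym e) e′))) mw)

  -- Entries keeping the head x start with x, the others with an element of xs.
  swaps-unique : ∀ xs → Unique xs → Unique (swaps xs)
  swaps-unique [] u = []ᴬ ∷ []
  swaps-unique (x ∷ xs) uu@(_ ∷ u) =
    ++⁺ (map⁺ ∷-injectiveʳ (swaps-unique xs u)) (frontSwaps-unique x [] xs (Unique[x∷xs]⇒x∉xs uu) u) disjoint
    where
    disjoint : ∀ {v} → ¬ (v ∈ map (x ∷_) (swaps xs) × v ∈ frontSwaps (x ∷ []) xs)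
    disjoint (m1 , m2) with ∈-map⁻ (x ∷_) m1 | frontSwaps-head∈ (x ∷ []) xs m2
    ... | z , _ , e | w , t′ , mw , e′ =
      Unique[x∷xs]⇒x∉xs uu (subst (_∈ xs) (sym (∷-injectiveˡ (trans (sym e) e′))) mw)

  length-insertAfterPrefix : ∀ X xs → length (insertAfterPrefix X xs) ≡ length xs
  length-insertAfterPrefix X [] = refl
  length-insertAfterPrefix X (y ∷ ys) =
    cong suc (trans (length-map (y ∷_) (insertAfterPrefix X ys)) (length-insertAfterPrefix X ys))

  length-frontSwaps : ∀ X xs → length (frontSwaps X xs) ≡ suc (length xs) C 2
  length-frontSwaps X [] = refl
  length-frontSwaps X (y ∷ ys) = begin
    length (insertAfterPrefix X (y ∷ ys) ++ frontSwaps (X ++ y ∷ []) ys)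
      ≡⟨ length-++ (insertAfterPrefix X (y ∷ ys)) ⟩
    length (insertAfterPrefix X (y ∷ ys)) + length (frontSwaps (X ++ y ∷ []) ys)
      ≡⟨ cong₂ _+_ (length-insertAfterPrefix X (y ∷ ys)) (length-frontSwaps (X ++ y ∷ []) ys) ⟩
    suc m + suc m C 2
      ≡⟨ cong (_+ suc m C 2) (sym (nC1≡n (suc m))) ⟩
    suc m C 1 + suc m C 2
      ≡⟨ nCk+nC[k+1]≡[n+1]C[k+1] (suc m) 1 ⟩
    suc (suc m) C 2 ∎
    where
    open ≡-Reasoning
    m = length ys

  length-swaps : ∀ xs → length (swaps xs) ≡ 1 + length xs C 2 + length xs C 3
  length-swaps [] = refl
  length-swaps (x ∷ xs) = begin
    length (map (x ∷_) (swaps xs) ++ frontSwaps (x ∷ []) xs)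
      ≡⟨ length-++ (map (x ∷_) (swaps xs)) ⟩
    length (map (x ∷_) (swaps xs)) + length (frontSwaps (x ∷ []) xs)
      ≡⟨ cong₂ _+_ (trans (length-map (x ∷_) (swaps xs)) (length-swaps xs)) (length-frontSwaps (x ∷ []) xs) ⟩
    1 + (m C 2 + m C 3) + suc m C 2
      ≡⟨ cong suc (+-comm (m C 2 + m C 3) (suc m C 2)) ⟩
    1 + suc m C 2 + (m C 2 + m C 3)
      ≡⟨ cong (1 + suc m C 2 +_) (nCk+nC[k+1]≡[n+1]C[k+1] m 2) ⟩
    1 + suc m C 2 + suc m C 3 ∎
    where
    open ≡-Reasoning
    m = length xs

perm-unique : ∀ {n} (π : Perm n) → Unique (proj₁ π)
perm-unique {n} (π , π↭) = Unique-resp-↭ (setoid (Fin n)) (↭⇒↭ₛ (↭-sym π↭)) (allFin⁺ n)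

theorem2 : (n : ℕ) → (π : Perm (suc n)) →
    ∃ λ (L : List (List (Fin (suc n)))) →
      Unique L ×
      (∀ ρ → (ρ ∈ L) ⇔ ((proj₁ π ⟶ ρ) × (ρ ⟶ proj₁ π))) ×
      (length L ≡ 1 + (suc n C 2) + (suc n C 3))
theorem2 n π@(xs , xs↭) = swaps xs , swaps-unique xs u , characterisation , count
  where
  u : Unique xs
  u = perm-unique π
  characterisation : ∀ ρ → (ρ ∈ swaps xs) ⇔ ((xs ⟶ ρ) × (ρ ⟶ xs))
  characterisation ρ = mk⇔ (swaps-sound xs)
    (λ (fwd , back) → tdrl-intersection-complete xs u ρ fwd back)
  length-xs : length xs ≡ suc n
  length-xs = trans (↭-length xs↭) (length-tabulate {n = suc n} (λ i → i))
  count : length (swaps xs) ≡ 1 + (suc n C 2) + (suc n C 3)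
  count = trans (length-swaps xs) (cong (λ m → 1 + m C 2 + m C 3) length-xs)
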